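{- The Thue system $S$ is almost confluent, and the homomorphism $h:\Sigma^*\to\mathbb{Z}$, $h(x)=|x|_a+|x|_b-|x|_{\overline{a}}-|x|_{\overline{b}}$, induces an isomorphism of the quotient monoid $\Sigma^*/\overset{*}{\leftrightarrow}_S$ with the additive group $\mathbb{Z}$.
   Context: $\Sigma=\{a,b,\overline{a},\overline{b}\}$, $\lambda$ the empty string, $|x|_e$ the number of occurrences of letter $e$ in $x$. $S$ is the Thue system with rules $(a\overline{a},\lambda),(\overline{a}a,\lambda),(a\overline{b},\lambda),(\overline{b}a,\lambda),(b\overline{a},\lambda),(\overline{a}b,\lambda),(b\overline{b},\lambda),(\overline{b}b,\lambda),(a,b),(b,a),(\overline{a},\overline{b}),(\overline{b},\overline{a})$. For a Thue system $T$: $x\leftrightarrow_T y$ if $x=tuv$, $y=twv$ with $(u,w)$ or $(w,u)$ in $T$; $\overset{*}{\leftrightarrow}_T$ is its reflexive-transitive closure (a congruence). $x\to_T y$ means $x\leftrightarrow_T y$ and $|x|>|y|$; $x\Leftrightarrow_T y$ means $x\leftrightarrow_T y$ and $|x|=|y|$; stars denote reflexive-transitive closures. $T$ is almost confluent if whenever $x\overset{*}{\leftrightarrow}_T y$ there exist $z_1,z_2$ with $x\overset{*}{\to}_T z_1$, $y\overset{*}{\to}_T z_2$ and $z_1\overset{*}{\Leftrightarrow}_T z_2$. -}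

module Defs where

open import Data.List using (List; []; _∷_; _++_; length; filter)
open import Data.List.Membership.Propositional using (_∈_)
open import Data.Product using (Σ; _×_; _,_; ∃; ∃-syntax)
open import Data.Sum using (_⊎_)
open import Data.Nat using (ℕ; _<_)
open import Data.Integer using (ℤ; +_; _-_; _+_)
open import Relation.Binary.PropositionalEquality using (_≡_; refl)
open import Relation.Binary.Construct.Closure.ReflexiveTransitive using (Star)
open import Relation.Nullary using (Dec; yes; no)

data Letter : Set where
  a b a̅ b̅ : Letter

_≟L_ : (x y : Letter) → Dec (x ≡ y)
a ≟L a = yes refl
a ≟L b = no λ ()
a ≟L a̅ = no λ ()
a ≟L b̅ = no λ ()
b ≟L a = no λ ()
b ≟L b = yes refl
b ≟L a̅ = no λ ()
b ≟L b̅ = no λ ()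
a̅ ≟L a = no λ ()
a̅ ≟L b = no λ ()
a̅ ≟L a̅ = yes refl
a̅ ≟L b̅ = no λ ()
b̅ ≟L a = no λ ()
b̅ ≟L b = no λ ()
b̅ ≟L a̅ = no λ ()
b̅ ≟L b̅ = yes refl

Word : Set
Word = List Letter

ε : Word
ε = []

ThueSystem : Set
ThueSystem = List (Word × Word)

S : ThueSystem
S = (a ∷ a̅ ∷ [] , ε) ∷ (a̅ ∷ a ∷ [] , ε) ∷ (a ∷ b̅ ∷ [] , ε) ∷ (b̅ ∷ a ∷ [] , ε)
  ∷ (b ∷ a̅ ∷ [] , ε) ∷ (a̅ ∷ b ∷ [] , ε) ∷ (b ∷ b̅ ∷ [] , ε) ∷ (b̅ ∷ b ∷ [] , ε)
  ∷ (a ∷ [] , b ∷ []) ∷ (b ∷ [] , a ∷ []) ∷ (a̅ ∷ [] , b̅ ∷ []) ∷ (b̅ ∷ [] , a̅ ∷ [])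
  ∷ []

Step : ThueSystem → Word → Word → Set
Step T x y = ∃[ t ] ∃[ u ] ∃[ v ] ∃[ w ]
  (x ≡ t ++ u ++ v) × (y ≡ t ++ w ++ v) × (((u , w) ∈ T) ⊎ ((w , u) ∈ T))

Red : ThueSystem → Word → Word → Set
Red T x y = Step T x y × (length y < length x)

Eqv : ThueSystem → Word → Word → Set
Eqv T x y = Step T x y × (length x ≡ length y)

Congr : ThueSystem → Word → Word → Set
Congr T = Star (Step T)

Red* : ThueSystem → Word → Word → Set
Red* T = Star (Red T)

Eqv* : ThueSystem → Word → Word → Set
Eqv* T = Star (Eqv T)

AlmostConfluent : ThueSystem → Set
AlmostConfluent T = ∀ x y → Congr T x y →
  ∃[ z₁ ] ∃[ z₂ ] (Red* T x z₁ × Red* T y z₂ × Eqv* T z₁ z₂)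

occ : Letter → Word → ℕ
occ e x = length (filter (_≟L e) x)

h : Word → ℤ
h x = (+ occ a x) + (+ occ b x) - (+ occ a̅ x) - (+ occ b̅ x)

-- h counts a and b as +1 and ā and b̄ as −1, and every rule of S preserves h, so h is constant on
-- congruence classes. Conversely, cancelling adjacent letters of opposite sign reduces any word to a
-- word whose letters all have the same sign, and renaming b to a and b̄ to ā (length-preserving)
-- turns such a word into the canonical word aⁿ or āⁿ determined by its h-value. Hence two
-- congruent words reduce to words that are length-preservingly equivalent, and a word is congruent
-- to the canonical word of its h-value, which makes h a bijection on classes.
module Submission where

open import Defs
open import Data.List using ([]; _∷_; _++_; length; replicate; filter)
open import Data.List.Properties using (++-assoc; length-++; length-replicate; filter-++)
open import Data.List.Relation.Unary.All as All using (All; []; _∷_)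
open import Data.List.Relation.Unary.All.Properties using (replicate⁺)
open import Data.List.Relation.Unary.Any using (here; there)
open import Data.List.Membership.Propositional using (_∈_)
open import Data.Product using (_×_; ∃-syntax; _,_; proj₁)
open import Data.Sum using (_⊎_; inj₁; inj₂; [_,_]′)
open import Data.Nat as ℕ using (zero; suc; s≤s)
open import Data.Nat.Properties using (n≤1+n)
open import Data.Integer using (ℤ; _+_; _-_; -_; 0ℤ; 1ℤ; -1ℤ; +_; -[1+_])
open import Data.Integer.Properties using (pos-+)
open import Data.Integer.Tactic.RingSolver using (solve-∀)
open import Relation.Binary.PropositionalEquality
  using (_≡_; refl; sym; trans; cong; cong₂; subst; module ≡-Reasoning)
open import Relation.Binary.Construct.Closure.ReflexiveTransitive
  using (Star; _◅_; _◅◅_; gmap; reverse) renaming (ε to ε★)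
open import Function.Bundles using (_⇔_; mk⇔)

private
  variable
    T : ThueSystem
    l m : Letter
    u v w x y z : Word

occ-++ : ∀ e x y → occ e (x ++ y) ≡ occ e x ℕ.+ occ e y
occ-++ e x y = trans (cong length (filter-++ (_≟L e) x y)) (length-++ (filter (_≟L e) x))

h-++ : ∀ x y → h (x ++ y) ≡ h x + h y
h-++ x y = begin
  h (x ++ y)
    ≡⟨ cong₂ _-_ (cong₂ _-_ (cong₂ _+_ (+occ-++ a) (+occ-++ b)) (+occ-++ a̅)) (+occ-++ b̅) ⟩
  (+ occ a x + + occ a y) + (+ occ b x + + occ b y)
    - (+ occ a̅ x + + occ a̅ y) - (+ occ b̅ x + + occ b̅ y)
    ≡⟨ regroup (+ occ a x) (+ occ a y) (+ occ b x) (+ occ b y)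
               (+ occ a̅ x) (+ occ a̅ y) (+ occ b̅ x) (+ occ b̅ y) ⟩
  h x + h y ∎
  where
  open ≡-Reasoning
  +occ-++ : ∀ e → + occ e (x ++ y) ≡ + occ e x + + occ e y
  +occ-++ e = trans (cong +_ (occ-++ e x y)) (pos-+ (occ e x) (occ e y))
  regroup : ∀ p p′ q q′ r r′ s s′ →
    (p + p′) + (q + q′) - (r + r′) - (s + s′) ≡ (p + q - r - s) + (p′ + q′ - r′ - s′)
  regroup = solve-∀

step-sym : Step T x y → Step T y x
step-sym (t , u , v , w , refl , refl , inj₁ r) = t , w , v , u , refl , refl , inj₂ r
step-sym (t , u , v , w , refl , refl , inj₂ r) = t , w , v , u , refl , refl , inj₁ r

rule-step : (u , w) ∈ T → Step T (u ++ v) (w ++ v)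
rule-step r = [] , _ , _ , _ , refl , refl , inj₁ r

step-∷ : Step T x y → Step T (l ∷ x) (l ∷ y)
step-∷ {l = l} (t , u , v , w , refl , refl , r) = l ∷ t , u , v , w , refl , refl , r

step-++ʳ : ∀ z → Step T x y → Step T (x ++ z) (y ++ z)
step-++ʳ z (t , u , v , w , refl , refl , r) =
  t , u , v ++ z , w , shift u , shift w , r
  where
  shift : ∀ u → (t ++ u ++ v) ++ z ≡ t ++ u ++ v ++ z
  shift u = trans (++-assoc t (u ++ v) z) (cong (t ++_) (++-assoc u v z))

red-∷ : Red T x y → Red T (l ∷ x) (l ∷ y)
red-∷ (s , shorter) = step-∷ s , s≤s shorter

eqv-∷ : Eqv T x y → Eqv T (l ∷ x) (l ∷ y)
eqv-∷ (s , same) = step-∷ s , cong suc same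

eqv-++ʳ : ∀ z → Eqv T x y → Eqv T (x ++ z) (y ++ z)
eqv-++ʳ {x = x} {y = y} z (s , same) =
  step-++ʳ z s , trans (length-++ x) (trans (cong (ℕ._+ length z) same) (sym (length-++ y)))

red*⇒congr : Red* T x y → Congr T x y
red*⇒congr = gmap (λ x → x) proj₁

eqv*⇒congr : Eqv* T x y → Congr T x y
eqv*⇒congr = gmap (λ x → x) proj₁

eqv*-sym : Eqv* T x y → Eqv* T y x
eqv*-sym = reverse λ (s , same) → step-sym s , sym same

replicate-eqv* : ∀ c → All (λ l → Eqv* T (l ∷ []) (c ∷ [])) z → Eqv* T z (replicate (length z) c)
replicate-eqv* c [] = ε★
replicate-eqv* {z = l ∷ z} c (l~c ∷ z~cs) =
  gmap (l ∷_) eqv-∷ (replicate-eqv* c z~cs) ◅◅ gmap (_++ replicate (length z) c) (eqv-++ʳ _) l~c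

step-preserves-h : (∀ {u w} → (u , w) ∈ T → h u ≡ h w) → Step T x y → h x ≡ h y
step-preserves-h balanced (t , u , v , w , refl , refl , r) = begin
  h (t ++ u ++ v)   ≡⟨ h-++ t (u ++ v) ⟩
  h t + h (u ++ v)  ≡⟨ cong (_+_ (h t)) (h-++ u v) ⟩
  h t + (h u + h v) ≡⟨ cong (λ k → h t + (k + h v)) ([ balanced , (λ r → sym (balanced r)) ]′ r) ⟩
  h t + (h w + h v) ≡⟨ cong (_+_ (h t)) (h-++ w v) ⟨
  h t + h (w ++ v)  ≡⟨ h-++ t (w ++ v) ⟨
  h (t ++ w ++ v)   ∎
  where
  open ≡-Reasoning

star-preserves-h : ∀ {R : Word → Word → Set} → (∀ {x y} → R x y → h x ≡ h y) →
                   Star R x y → h x ≡ h y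
star-preserves-h preserves ε★ = refl
star-preserves-h preserves (s ◅ ss) = trans (preserves s) (star-preserves-h preserves ss)

S-balanced : (u , w) ∈ S → h u ≡ h w
S-balanced = All.lookup {P = λ (u , w) → h u ≡ h w}
  (refl ∷ refl ∷ refl ∷ refl ∷ refl ∷ refl ∷ refl ∷ refl ∷ refl ∷ refl ∷ refl ∷ refl ∷ [])

congr-preserves-h : Congr S x y → h x ≡ h y
congr-preserves-h = star-preserves-h (step-preserves-h S-balanced)

red*-preserves-h : Red* S x y → h x ≡ h y
red*-preserves-h = star-preserves-h (λ r → step-preserves-h S-balanced (proj₁ r))

data Positive : Letter → Set where
  a⁺ : Positive a
  b⁺ : Positive b

data Negative : Letter → Set where
  a̅⁻ : Negative a̅
  b̅⁻ : Negative b̅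

polarity : ∀ l → Positive l ⊎ Negative l
polarity a = inj₁ a⁺
polarity b = inj₁ b⁺
polarity a̅ = inj₂ a̅⁻
polarity b̅ = inj₂ b̅⁻

cancel-positive-negative : Positive l → Negative m → (l ∷ m ∷ [] , ε) ∈ S
cancel-positive-negative a⁺ a̅⁻ = here refl
cancel-positive-negative a⁺ b̅⁻ = there (there (here refl))
cancel-positive-negative b⁺ a̅⁻ = there (there (there (there (here refl))))
cancel-positive-negative b⁺ b̅⁻ = there (there (there (there (there (there (here refl))))))

cancel-negative-positive : Negative l → Positive m → (l ∷ m ∷ [] , ε) ∈ S
cancel-negative-positive a̅⁻ a⁺ = there (here refl)
cancel-negative-positive b̅⁻ a⁺ = there (there (there (here refl)))
cancel-negative-positive a̅⁻ b⁺ = there (there (there (there (there (here refl)))))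
cancel-negative-positive b̅⁻ b⁺ = there (there (there (there (there (there (there (here refl)))))))

b→a∈S : (b ∷ [] , a ∷ []) ∈ S
b→a∈S = there (there (there (there (there (there (there (there (there (here refl)))))))))

b̅→a̅∈S : (b̅ ∷ [] , a̅ ∷ []) ∈ S
b̅→a̅∈S = there (there (there (there (there (there (there (there (there (there (there
  (here refl)))))))))))

positive-eqv*-a : Positive l → Eqv* S (l ∷ []) (a ∷ [])
positive-eqv*-a a⁺ = ε★
positive-eqv*-a b⁺ = (rule-step b→a∈S , refl) ◅ ε★

negative-eqv*-a̅ : Negative l → Eqv* S (l ∷ []) (a̅ ∷ [])
negative-eqv*-a̅ a̅⁻ = ε★
negative-eqv*-a̅ b̅⁻ = (rule-step b̅→a̅∈S , refl) ◅ ε★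

h-positive : All Positive z → h z ≡ + length z
h-positive [] = refl
h-positive {l ∷ z} (a⁺ ∷ ps) = trans (h-++ (a ∷ []) z) (cong (_+_ 1ℤ) (h-positive ps))
h-positive {l ∷ z} (b⁺ ∷ ps) = trans (h-++ (b ∷ []) z) (cong (_+_ 1ℤ) (h-positive ps))

h-negative : All Negative z → h z ≡ - + length z
h-negative [] = refl
h-negative {l ∷ z} (n ∷ ns) = begin
  h (l ∷ z)              ≡⟨ h-++ (l ∷ []) z ⟩
  h (l ∷ []) + h z       ≡⟨ cong₂ _+_ (h-letter n) (h-negative ns) ⟩
  -1ℤ + - + length z     ≡⟨ pred-neg (length z) ⟩
  - + suc (length z)     ∎
  where
  open ≡-Reasoning
  h-letter : Negative l → h (l ∷ []) ≡ -1ℤ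
  h-letter a̅⁻ = refl
  h-letter b̅⁻ = refl
  pred-neg : ∀ n → -1ℤ + - + n ≡ - + suc n
  pred-neg zero = refl
  pred-neg (suc n) = refl

OneSigned : Word → Set
OneSigned z = All Positive z ⊎ All Negative z

cancel-red : (l ∷ m ∷ [] , ε) ∈ S → Red S (l ∷ m ∷ z) z
cancel-red r = rule-step r , s≤s (n≤1+n _)

∷-one-signed : ∀ l → OneSigned z → ∃[ z′ ] (Red* S (l ∷ z) z′ × OneSigned z′)
∷-one-signed {z} l os with polarity l | os
... | inj₁ p | inj₁ ps       = l ∷ z , ε★ , inj₁ (p ∷ ps)
... | inj₁ p | inj₂ []       = l ∷ [] , ε★ , inj₁ (p ∷ [])
... | inj₁ p | inj₂ (n ∷ ns) = _ , cancel-red (cancel-positive-negative p n) ◅ ε★ , inj₂ ns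
... | inj₂ n | inj₂ ns       = l ∷ z , ε★ , inj₂ (n ∷ ns)
... | inj₂ n | inj₁ []       = l ∷ [] , ε★ , inj₂ (n ∷ [])
... | inj₂ n | inj₁ (p ∷ ps) = _ , cancel-red (cancel-negative-positive n p) ◅ ε★ , inj₁ ps

reduce-to-one-signed : ∀ x → ∃[ z ] (Red* S x z × OneSigned z)
reduce-to-one-signed [] = [] , ε★ , inj₁ []
reduce-to-one-signed (l ∷ x) with reduce-to-one-signed x
... | z , x↠z , os with ∷-one-signed l os
... | z′ , lz↠z′ , os′ = z′ , gmap (l ∷_) red-∷ x↠z ◅◅ lz↠z′ , os′

canonical : ℤ → Word
canonical (+ n) = replicate n a
canonical -[1+ n ] = replicate (suc n) a̅

h-canonical : ∀ n → h (canonical n) ≡ n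
h-canonical (+ n) =
  trans (h-positive (replicate⁺ n a⁺)) (cong +_ (length-replicate n))
h-canonical -[1+ n ] =
  trans (h-negative (replicate⁺ (suc n) a̅⁻)) (cong (λ k → - + k) (length-replicate (suc n)))

canonical-neg : ∀ n → canonical (- + n) ≡ replicate n a̅
canonical-neg zero = refl
canonical-neg (suc n) = refl

one-signed-eqv*-canonical : OneSigned z → Eqv* S z (canonical (h z))
one-signed-eqv*-canonical (inj₁ ps) rewrite h-positive ps =
  replicate-eqv* a (All.map positive-eqv*-a ps)
one-signed-eqv*-canonical {z} (inj₂ ns) rewrite h-negative ns | canonical-neg (length z) =
  replicate-eqv* a̅ (All.map negative-eqv*-a̅ ns)

normalise : ∀ x → ∃[ z ] (Red* S x z × Eqv* S z (canonical (h x)))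
normalise x with reduce-to-one-signed x
... | z , x↠z , os = z , x↠z ,
  subst (λ k → Eqv* S z (canonical k)) (sym (red*-preserves-h x↠z)) (one-signed-eqv*-canonical os)

congr-canonical : ∀ x → Congr S x (canonical (h x))
congr-canonical x with normalise x
... | z , x↠z , z⇔c = red*⇒congr x↠z ◅◅ eqv*⇒congr z⇔c

S-almostConfluent : AlmostConfluent S
S-almostConfluent x y x~y with normalise x | normalise y
... | z₁ , x↠z₁ , z₁⇔cx | z₂ , y↠z₂ , z₂⇔cy = z₁ , z₂ , x↠z₁ , y↠z₂ ,
  z₁⇔cx ◅◅ subst (λ k → Eqv* S (canonical k) z₂) (sym (congr-preserves-h x~y)) (eqv*-sym z₂⇔cy)

mainTheorem3 : AlmostConfluent S
    × (h ε ≡ 0ℤ)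
    × (∀ x y → h (x ++ y) ≡ h x + h y)
    × (∀ x y → Congr S x y ⇔ (h x ≡ h y))
    × (∀ (n : ℤ) → ∃[ x ] (h x ≡ n))
mainTheorem3 = S-almostConfluent , refl , h-++ , congr⇔same-h , λ n → canonical n , h-canonical n
  where
  congr⇔same-h : ∀ x y → Congr S x y ⇔ (h x ≡ h y)
  congr⇔same-h x y = mk⇔ congr-preserves-h λ hx≡hy →
    congr-canonical x ◅◅ subst (λ k → Congr S (canonical k) y) (sym hx≡hy)
      (reverse step-sym (congr-canonical y))
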